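{- Let $X$ be the array of all $(k+1)m$ suffixes of $S$ sorted lexicographically by their extended strings, and let $LCP$ be the array of length $(k+1)m$ such that, for $2\le i\le (k+1)m$, $LCP[i]$ is the length of the longest common prefix of the extended strings of $X[i-1]$ and $X[i]$. Then for every position $2\le i\le (k+1)m$, $LCP[i]$ is the largest integer $p\ge 0$ such that $i$ is the start position of a $(p+1)$-segment of $X^{p+1}$ and $i$ is not the start position of a $p$-segment of $X^{p}$.
   Context: Let $S=\{s_1,\dots,s_m\}$ be strings each of exactly $k$ symbols over a totally ordered alphabet $\Sigma'=\{c_1<\dots<c_\sigma\}$; $s_j[i]$ denotes the $i$-th symbol. Each $s_j$ is terminated by its own sentinel $\$_j$, with $\$_1<\$_2<\dots<\$_m<c_1$. A suffix of $S$ is a pair $\alpha=(l,j)$ with $0\le l\le k$, $1\le j\le m$, representing the $l$-suffix $s_j[k-l+1:k]$ of $s_j$ (empty if $l=0$); its length is $l_\alpha=l$ and its string index is $i_\alpha=j$. Its extended string is $\bar\alpha=s_j[k-l+1:k]\,\$_j$. For an integer $p\ge 0$, the $p$-prefix $\alpha[:p]$ is the prefix of $\bar\alpha$ of length $\min(p,l+1)$. For $p\ge0$, $\alpha\prec_p\beta$ iff (1) $\alpha[:p]$ is lexicographically strictly smaller than $\beta[:p]$, or (2) $\alpha[:p]=\beta[:p]$ and $l_\alpha<l_\beta$, or (3) $\alpha[:p]=\beta[:p]$, $l_\alpha=l_\beta$ and $i_\alpha<i_\beta$. The $p$-interleave $X^p$ is the array of length $(k+1)m$ whose $i$-th entry is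 the $i$-th smallest suffix in the $\prec_p$ order. A $p$-segment of $X^p$ is a maximal interval $[b,e]$ of positions such that all suffixes $X^p[b],\dots,X^p[e]$ have the same $p$-prefix; $b$ is its start position. (The paper sets $LCP[1]=-1$ by convention.) -}

module Defs where

open import Data.Nat using (ℕ; zero; suc; _+_; _*_; _∸_; _≤_; _<_)
open import Data.Fin using (Fin; toℕ)
import Data.Fin as F
open import Data.Fin.Properties using () renaming (_≟_ to _≟F_)
open import Data.List using (List; []; _∷_; _++_; [_]; map; drop; take)
open import Data.Vec using (Vec; toList)
open import Data.Product using (_×_; _,_; proj₁; proj₂; ∃)
open import Data.Sum using (_⊎_)
open import Relation.Nullary using (¬_; Dec; yes; no)
open import Relation.Binary.PropositionalEquality using (_≡_; refl; cong)

-- Symbols of extended strings: sentinels $_1 < ... < $_m, then letters c_1 < ... < c_σ.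
-- Sentinel $_j is  sent j  (j : Fin m, 0-based), letter c_a is  chr a  (a : Fin σ, 0-based).
data Sym (m σ : ℕ) : Set where
  sent : Fin m → Sym m σ
  chr  : Fin σ → Sym m σ

module _ {m σ : ℕ} where

  data _<S_ : Sym m σ → Sym m σ → Set where
    sent<sent : ∀ {i j} → i F.< j → sent i <S sent j
    sent<chr  : ∀ {i a} → sent i <S chr a
    chr<chr   : ∀ {a b} → a F.< b → chr a <S chr b

  _≟S_ : (x y : Sym m σ) → Dec (x ≡ y)
  sent i ≟S sent j with i ≟F j
  ... | yes refl = yes refl
  ... | no ne = no λ { refl → ne refl }
  sent i ≟S chr b = no λ ()
  chr a ≟S sent j = no λ ()
  chr a ≟S chr b with a ≟F b
  ... | yes refl = yes refl
  ... | no ne = no λ { refl → ne refl }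

  data LexLt : List (Sym m σ) → List (Sym m σ) → Set where
    lex-nil   : ∀ {y ys} → LexLt [] (y ∷ ys)
    lex-here  : ∀ {x y xs ys} → x <S y → LexLt (x ∷ xs) (y ∷ ys)
    lex-there : ∀ {x xs ys} → LexLt xs ys → LexLt (x ∷ xs) (x ∷ ys)

  lcp : List (Sym m σ) → List (Sym m σ) → ℕ
  lcp (x ∷ xs) (y ∷ ys) with x ≟S y
  ... | yes _ = suc (lcp xs ys)
  ... | no _ = 0
  lcp _ _ = 0

-- A suffix (l , j) : l ∈ {0..k} is the length, j the (0-based) string index.
Suffix : ℕ → ℕ → Set
Suffix k m = Fin (suc k) × Fin m

len : ∀ {k m} → Suffix k m → Fin (suc k)
len = proj₁

idx : ∀ {k m} → Suffix k m → Fin m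
idx = proj₂

Strings : ℕ → ℕ → ℕ → Set
Strings k m σ = Fin m → Vec (Fin σ) k

module _ {k m σ : ℕ} (s : Strings k m σ) where

  -- extended string  s_j[k-l+1 : k] $_j
  ext : Suffix k m → List (Sym m σ)
  ext (l , j) = map chr (drop (k ∸ toℕ l) (toList (s j))) ++ [ sent j ]

  pre : ℕ → Suffix k m → List (Sym m σ)
  pre p α = take p (ext α)

  Prec : ℕ → Suffix k m → Suffix k m → Set
  Prec p α β = LexLt (pre p α) (pre p β)
             ⊎ (pre p α ≡ pre p β
                × (toℕ (len α) < toℕ (len β)
                   ⊎ (toℕ (len α) ≡ toℕ (len β) × toℕ (idx α) < toℕ (idx β))))

  ExtLt : Suffix k m → Suffix k m → Set
  ExtLt α β = LexLt (ext α) (ext β)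

-- Arrays are 1-indexed: positions 1..N of a function ℕ → A.
-- X is sorted strictly increasingly w.r.t. R on positions 1..N.
SortedBy : ∀ {A : Set} → (A → A → Set) → ℕ → (ℕ → A) → Set
SortedBy R N X = ∀ a b → 1 ≤ a → a < b → b ≤ N → R (X a) (X b)

Covers : ∀ {A : Set} → ℕ → (ℕ → A) → Set
Covers {A} N X = (α : A) → ∃ λ i → 1 ≤ i × i ≤ N × X i ≡ α

IsSortedArray : ∀ {A : Set} → (A → A → Set) → ℕ → (ℕ → A) → Set
IsSortedArray R N X = SortedBy R N X × Covers N X

module _ {k m σ : ℕ} (s : Strings k m σ) where

  N : ℕ
  N = suc k * m

  SamePrefix : ℕ → (ℕ → Suffix k m) → ℕ → ℕ → Set
  SamePrefix p Y b e = ∀ x y → b ≤ x → x ≤ e → b ≤ y → y ≤ e → pre s p (Y x) ≡ pre s p (Y y)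

  IsSegment : ℕ → (ℕ → Suffix k m) → ℕ → ℕ → Set
  IsSegment p Y b e =
    1 ≤ b × b ≤ e × e ≤ N × SamePrefix p Y b e
    × (∀ b' e' → 1 ≤ b' → b' ≤ b → e ≤ e' → e' ≤ N → SamePrefix p Y b' e' → b' ≡ b × e' ≡ e)

  IsSegmentStart : ℕ → (ℕ → Suffix k m) → ℕ → Set
  IsSegmentStart p Y b = ∃ λ e → IsSegment p Y b e

  LCP : (ℕ → Suffix k m) → ℕ → ℕ
  LCP X i = lcp (ext s (X (i ∸ 1))) (ext s (X i))

IsLargest : (ℕ → Set) → ℕ → Set
IsLargest P n = P n × (∀ p → P p → p ≤ n)

-- Both X and X^p list all suffixes in an order compatible with p-prefixes, so by
-- pigeonhole they have the same p-prefix boundaries: a position is a p-boundary of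
-- one exactly when it is one of the other. Hence i starts a p-segment of X^p iff the
-- p-prefixes of X[i-1] and X[i] differ, and LCP[i] is the largest p at which the
-- (p+1)-prefixes differ while the p-prefixes agree.
module Submission where

open import Defs
open import Data.Nat using (ℕ; zero; suc; _+_; _∸_; _≤_; _<_; z≤n; s≤s; _≤?_; _≟_)
open import Data.Nat.Properties
open import Data.Fin using (Fin; toℕ; fromℕ<) renaming (_<_ to _<ᶠ_)
import Data.Fin.Properties as Fin
open import Data.List using (List; []; _∷_; take)
open import Data.List.Properties using (∷-injectiveˡ; ∷-injectiveʳ; ≡-dec)
open import Data.Product using (_×_; _,_; proj₁; proj₂; ∃; ∃₂)
open import Data.Sum using (_⊎_; inj₁; inj₂)
open import Data.Empty using (⊥-elim)
open import Function using (_∘_)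
open import Relation.Nullary using (¬_; yes; no)
open import Relation.Nullary.Decidable using (decidable-stable)
open import Relation.Unary using (Decidable)
open import Relation.Binary.PropositionalEquality

module _ {m σ : ℕ} where

  <S-irrefl : ∀ {x : Sym m σ} → ¬ (x <S x)
  <S-irrefl (sent<sent i<i) = Fin.<-irrefl refl i<i
  <S-irrefl (chr<chr a<a) = Fin.<-irrefl refl a<a

  <S-trans : ∀ {x y z : Sym m σ} → x <S y → y <S z → x <S z
  <S-trans (sent<sent p) (sent<sent q) = sent<sent (Fin.<-trans p q)
  <S-trans (sent<sent p) sent<chr = sent<chr
  <S-trans sent<chr (chr<chr q) = sent<chr
  <S-trans (chr<chr p) (chr<chr q) = chr<chr (Fin.<-trans p q)

  LexLt-irrefl : ∀ {xs : List (Sym m σ)} → ¬ LexLt xs xs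
  LexLt-irrefl (lex-here p) = <S-irrefl p
  LexLt-irrefl (lex-there p) = LexLt-irrefl p

  LexLt-trans : ∀ {xs ys zs : List (Sym m σ)} → LexLt xs ys → LexLt ys zs → LexLt xs zs
  LexLt-trans lex-nil (lex-here _) = lex-nil
  LexLt-trans lex-nil (lex-there _) = lex-nil
  LexLt-trans (lex-here p) (lex-here q) = lex-here (<S-trans p q)
  LexLt-trans (lex-here p) (lex-there q) = lex-here p
  LexLt-trans (lex-there p) (lex-here q) = lex-here q
  LexLt-trans (lex-there p) (lex-there q) = lex-there (LexLt-trans p q)

  _≤L_ : List (Sym m σ) → List (Sym m σ) → Set
  xs ≤L ys = LexLt xs ys ⊎ xs ≡ ys

  ≤L-<-trans : ∀ {xs ys zs} → xs ≤L ys → LexLt ys zs → LexLt xs zs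
  ≤L-<-trans (inj₁ p) q = LexLt-trans p q
  ≤L-<-trans (inj₂ refl) q = q

  ≤L-trans : ∀ {xs ys zs} → xs ≤L ys → ys ≤L zs → xs ≤L zs
  ≤L-trans p (inj₁ q) = inj₁ (≤L-<-trans p q)
  ≤L-trans p (inj₂ refl) = p

  <-≤L-trans : ∀ {xs ys zs} → LexLt xs ys → ys ≤L zs → LexLt xs zs
  <-≤L-trans p (inj₁ q) = LexLt-trans p q
  <-≤L-trans p (inj₂ refl) = p

  LexLt⇒≱L : ∀ {xs ys} → LexLt xs ys → ¬ ys ≤L xs
  LexLt⇒≱L p q = LexLt-irrefl (≤L-<-trans q p)

  LexLt⇒take-≤L : ∀ {xs ys : List (Sym m σ)} → LexLt xs ys → ∀ p → take p xs ≤L take p ys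
  LexLt⇒take-≤L _ zero = inj₂ refl
  LexLt⇒take-≤L lex-nil (suc p) = inj₁ lex-nil
  LexLt⇒take-≤L (lex-here q) (suc p) = inj₁ (lex-here q)
  LexLt⇒take-≤L {x ∷ _} (lex-there q) (suc p) with LexLt⇒take-≤L q p
  ... | inj₁ r = inj₁ (lex-there r)
  ... | inj₂ r = inj₂ (cong (x ∷_) r)

  take-lcp : ∀ (xs ys : List (Sym m σ)) → take (lcp xs ys) xs ≡ take (lcp xs ys) ys
  take-lcp [] ys = refl
  take-lcp (x ∷ xs) [] = refl
  take-lcp (x ∷ xs) (y ∷ ys) with x ≟S y
  ... | yes refl = cong (x ∷_) (take-lcp xs ys)
  ... | no _ = refl

  take-suc-lcp-≢ : ∀ (xs ys : List (Sym m σ)) → xs ≢ ys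
    → take (suc (lcp xs ys)) xs ≢ take (suc (lcp xs ys)) ys
  take-suc-lcp-≢ [] [] xs≢ys _ = xs≢ys refl
  take-suc-lcp-≢ [] (y ∷ ys) xs≢ys ()
  take-suc-lcp-≢ (x ∷ xs) [] xs≢ys ()
  take-suc-lcp-≢ (x ∷ xs) (y ∷ ys) xs≢ys eq with x ≟S y
  ... | yes refl = take-suc-lcp-≢ xs ys (xs≢ys ∘ cong (x ∷_)) (∷-injectiveʳ eq)
  ... | no x≢y = x≢y (∷-injectiveˡ eq)

  take≡⇒≤lcp : ∀ p (xs ys : List (Sym m σ)) → take p xs ≡ take p ys → xs ≢ ys → p ≤ lcp xs ys
  take≡⇒≤lcp zero xs ys _ _ = z≤n
  take≡⇒≤lcp (suc p) [] [] _ xs≢ys = ⊥-elim (xs≢ys refl)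
  take≡⇒≤lcp (suc p) (x ∷ xs) (y ∷ ys) eq xs≢ys with x ≟S y
  ... | yes refl = s≤s (take≡⇒≤lcp p xs ys (∷-injectiveʳ eq) (xs≢ys ∘ cong (x ∷_)))
  ... | no x≢y = ⊥-elim (x≢y (∷-injectiveˡ eq))

  lcp-isLargest : ∀ {xs ys : List (Sym m σ)} → xs ≢ ys
    → IsLargest (λ p → take (suc p) xs ≢ take (suc p) ys × take p xs ≡ take p ys) (lcp xs ys)
  lcp-isLargest {xs} {ys} xs≢ys =
    (take-suc-lcp-≢ xs ys xs≢ys , take-lcp xs ys) ,
    λ p (_ , eq) → take≡⇒≤lcp p xs ys eq xs≢ys

IsLargest-cong : ∀ {P Q : ℕ → Set} {n} → (∀ p → P p → Q p) → (∀ p → Q p → P p)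
  → IsLargest P n → IsLargest Q n
IsLargest-cong P⇒Q Q⇒P (Pn , largest) = P⇒Q _ Pn , λ p → largest p ∘ Q⇒P p

pigeonhole-interval : ∀ lo c n (g : ℕ → ℕ) → (∀ x → lo ≤ x → x ≤ lo + n → c ≤ g x × g x < c + n)
  → ∃₂ λ x y → lo ≤ x × x < y × y ≤ lo + n × g x ≡ g y
pigeonhole-interval lo c n g range = collision (Fin.pigeonhole (n<1+n n) slot)
  where
  open ≡-Reasoning
  in-range : (i : Fin (suc n)) → c ≤ g (lo + toℕ i) × g (lo + toℕ i) < c + n
  in-range i = range (lo + toℕ i) (m≤m+n lo (toℕ i)) (+-monoʳ-≤ lo (Fin.toℕ≤pred[n] i))
  offset<n : (i : Fin (suc n)) → g (lo + toℕ i) ∸ c < n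
  offset<n i = subst (g (lo + toℕ i) ∸ c <_) (m+n∸m≡n c n) (∸-monoˡ-< (proj₂ (in-range i)) (proj₁ (in-range i)))
  slot : Fin (suc n) → Fin n
  slot i = fromℕ< (offset<n i)
  collision : ∃₂ (λ i j → i <ᶠ j × slot i ≡ slot j)
    → ∃₂ λ x y → lo ≤ x × x < y × y ≤ lo + n × g x ≡ g y
  collision (i , j , i<j , slot-i≡slot-j) =
    lo + toℕ i , lo + toℕ j , m≤m+n lo (toℕ i) , +-monoʳ-< lo i<j , +-monoʳ-≤ lo (Fin.toℕ≤pred[n] j) ,
    ∸-cancelʳ-≡ (proj₁ (in-range i)) (proj₁ (in-range j)) (begin
      g (lo + toℕ i) ∸ c     ≡⟨ Fin.toℕ-fromℕ< (offset<n i) ⟨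
      toℕ (slot i)           ≡⟨ cong toℕ slot-i≡slot-j ⟩
      toℕ (slot j)           ≡⟨ Fin.toℕ-fromℕ< (offset<n j) ⟩
      g (lo + toℕ j) ∸ c     ∎)

maximal-run : ∀ {Q : ℕ → Set} → Decidable Q → ∀ {b n} → b ≤ n → Q b
  → ∃ λ e → b ≤ e × e ≤ n × (∀ x → b ≤ x → x ≤ e → Q x) × (e < n → ¬ Q (suc e))
maximal-run {Q} Q? {b} {n} b≤n Qb = extend (n ∸ b) b (m+[n∸m]≡n b≤n) ≤-refl first
  where
  first : ∀ x → b ≤ x → x ≤ b → Q x
  first x b≤x x≤b = subst Q (≤-antisym b≤x x≤b) Qb
  extend : ∀ d e → e + d ≡ n → b ≤ e → (∀ x → b ≤ x → x ≤ e → Q x)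
    → ∃ λ e → b ≤ e × e ≤ n × (∀ x → b ≤ x → x ≤ e → Q x) × (e < n → ¬ Q (suc e))
  extend zero e e+0≡n b≤e run =
    e , b≤e , subst (e ≤_) e+0≡n (m≤m+n e 0) , run ,
    λ e<n → ⊥-elim (<-irrefl (trans (sym (+-identityʳ e)) e+0≡n) e<n)
  extend (suc d) e e+d≡n b≤e run with Q? (suc e)
  ... | no ¬Q-next = e , b≤e , subst (e ≤_) e+d≡n (m≤m+n e (suc d)) , run , λ _ → ¬Q-next
  ... | yes Q-next = extend d (suc e) (trans (sym (+-suc e d)) e+d≡n) (m≤n⇒m≤1+n b≤e) run′
    where
    run′ : ∀ x → b ≤ x → x ≤ suc e → Q x
    run′ x b≤x x≤1+e with x ≤? e
    ... | yes x≤e = run x b≤x x≤e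
    ... | no x≰e = subst Q (≤-antisym (≰⇒> x≰e) x≤1+e) Q-next

module KeyedArray {m σ : ℕ} {A : Set} (key : A → List (Sym m σ)) (n : ℕ) where

  record KeySorted (Y : ℕ → A) : Set where
    field
      monotone  : ∀ a b → 1 ≤ a → a ≤ b → b ≤ n → key (Y a) ≤L key (Y b)
      injective : ∀ a b → 1 ≤ a → a < b → b ≤ n → Y a ≢ Y b
      covers    : Covers n Y

  sorted⇒keySorted : ∀ {R : A → A → Set} {Y : ℕ → A}
    → (∀ α β → R α β → key α ≤L key β) → (∀ α → ¬ R α α)
    → IsSortedArray R n Y → KeySorted Y
  sorted⇒keySorted {R} {Y} R⇒≤L R-irrefl (sorted , covers) = record
    { monotone  = monotone
    ; injective = λ a b 1≤a a<b b≤n Ya≡Yb →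
        R-irrefl (Y b) (subst (λ α → R α (Y b)) Ya≡Yb (sorted a b 1≤a a<b b≤n))
    ; covers    = covers
    }
    where
    monotone : ∀ a b → 1 ≤ a → a ≤ b → b ≤ n → key (Y a) ≤L key (Y b)
    monotone a b 1≤a a≤b b≤n with a ≟ b
    ... | yes refl = inj₂ refl
    ... | no a≢b = R⇒≤L (Y a) (Y b) (sorted a b 1≤a (≤∧≢⇒< a≤b a≢b) b≤n)

  Boundary : (ℕ → A) → ℕ → Set
  Boundary Y j = key (Y j) ≢ key (Y (suc j))

  module _ {Y Z : ℕ → A} (Y-sorted : KeySorted Y) (Z-sorted : KeySorted Z)
           {j : ℕ} (1≤j : 1 ≤ j) (1+j≤n : suc j ≤ n) (Z-boundary : Boundary Z j) where
    private
      module Ys = KeySorted Y-sorted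
      module Zs = KeySorted Z-sorted

      j≤n : j ≤ n
      j≤n = ≤-trans (n≤1+n j) 1+j≤n

      pos : A → ℕ
      pos α = proj₁ (Zs.covers α)

      1≤pos : ∀ α → 1 ≤ pos α
      1≤pos α = proj₁ (proj₂ (Zs.covers α))

      pos≤n : ∀ α → pos α ≤ n
      pos≤n α = proj₁ (proj₂ (proj₂ (Zs.covers α)))

      key-Z-pos : ∀ α → key (Z (pos α)) ≡ key α
      key-Z-pos α = cong key (proj₂ (proj₂ (proj₂ (Zs.covers α))))

      Low : A → Set
      Low α = key α ≤L key (Z j)

      Z-jump : ∀ b → j < b → b ≤ n → LexLt (key (Z j)) (key (Z b))
      Z-jump b j<b b≤n with Zs.monotone j (suc j) 1≤j (n≤1+n j) 1+j≤n
      ... | inj₁ lt = <-≤L-trans lt (Zs.monotone (suc j) b (s≤s z≤n) j<b b≤n)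
      ... | inj₂ eq = ⊥-elim (Z-boundary eq)

      low⇒pos≤j : ∀ α → Low α → pos α ≤ j
      low⇒pos≤j α low with pos α ≤? j
      ... | yes pos≤j = pos≤j
      ... | no pos≰j = ⊥-elim (LexLt⇒≱L (Z-jump (pos α) (≰⇒> pos≰j) (pos≤n α))
                                       (subst (_≤L key (Z j)) (sym (key-Z-pos α)) low))

      pos≤j⇒low : ∀ α → pos α ≤ j → Low α
      pos≤j⇒low α pos≤j = subst (_≤L key (Z j)) (key-Z-pos α) (Zs.monotone (pos α) j (1≤pos α) pos≤j j≤n)

      no-collision : ¬ (∃₂ λ x y → 1 ≤ x × x < y × y ≤ n × pos (Y x) ≡ pos (Y y))
      no-collision (x , y , 1≤x , x<y , y≤n , same-pos) =
        Ys.injective x y 1≤x x<y y≤n (begin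
          Y x              ≡⟨ proj₂ (proj₂ (proj₂ (Zs.covers (Y x)))) ⟨
          Z (pos (Y x))    ≡⟨ cong Z same-pos ⟩
          Z (pos (Y y))    ≡⟨ proj₂ (proj₂ (proj₂ (Zs.covers (Y y)))) ⟩
          Y y              ∎)
        where open ≡-Reasoning

    -- If Y had no boundary at j, then either Y j and hence all of Y 1, ..., Y (j + 1)
    -- sit among the first j entries of Z, or Y j and hence all of Y j, ..., Y n sit
    -- among the last n ∸ j; either way pigeonhole contradicts injectivity of Y.
    boundary-transfer : Boundary Y j
    boundary-transfer Y-flat with pos (Y j) ≤? j
    ... | yes pos≤j = no-collision (low-collision (pigeonhole-interval 1 1 j (pos ∘ Y) low-range))
      where
      low-range : ∀ x → 1 ≤ x → x ≤ 1 + j → 1 ≤ pos (Y x) × pos (Y x) < 1 + j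
      low-range x 1≤x x≤1+j = 1≤pos (Y x) , s≤s (low⇒pos≤j (Y x)
        (≤L-trans (Ys.monotone x (suc j) 1≤x x≤1+j 1+j≤n)
                  (≤L-trans (inj₂ (sym Y-flat)) (pos≤j⇒low (Y j) pos≤j))))
      low-collision : (∃₂ λ x y → 1 ≤ x × x < y × y ≤ 1 + j × pos (Y x) ≡ pos (Y y))
        → ∃₂ λ x y → 1 ≤ x × x < y × y ≤ n × pos (Y x) ≡ pos (Y y)
      low-collision (x , y , 1≤x , x<y , y≤1+j , eq) = x , y , 1≤x , x<y , ≤-trans y≤1+j 1+j≤n , eq
    ... | no pos≰j = no-collision (high-collision (pigeonhole-interval j (suc j) (n ∸ j) (pos ∘ Y) high-range))
      where
      j+[n∸j]≡n : j + (n ∸ j) ≡ n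
      j+[n∸j]≡n = m+[n∸m]≡n j≤n
      high-range : ∀ x → j ≤ x → x ≤ j + (n ∸ j) → suc j ≤ pos (Y x) × pos (Y x) < suc j + (n ∸ j)
      high-range x j≤x x≤j+[n∸j] with pos (Y x) ≤? j
      ... | no pos≰j′ = ≰⇒> pos≰j′ , s≤s (subst (pos (Y x) ≤_) (sym j+[n∸j]≡n) (pos≤n (Y x)))
      ... | yes pos≤j = ⊥-elim (pos≰j (low⇒pos≤j (Y j)
        (≤L-trans (Ys.monotone j x 1≤j j≤x (subst (x ≤_) j+[n∸j]≡n x≤j+[n∸j])) (pos≤j⇒low (Y x) pos≤j))))
      high-collision : (∃₂ λ x y → j ≤ x × x < y × y ≤ j + (n ∸ j) × pos (Y x) ≡ pos (Y y))
        → ∃₂ λ x y → 1 ≤ x × x < y × y ≤ n × pos (Y x) ≡ pos (Y y)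
      high-collision (x , y , j≤x , x<y , y≤ , eq) =
        x , y , ≤-trans 1≤j j≤x , x<y , subst (y ≤_) j+[n∸j]≡n y≤ , eq

module _ {k m σ : ℕ} (s : Strings k m σ) (p : ℕ) (Y : ℕ → Suffix k m) {j : ℕ} (1≤j : 1 ≤ j) where
  private
    P : ℕ → List (Sym m σ)
    P x = pre s p (Y x)

  segmentStart⇒boundary : IsSegmentStart s p Y (suc j) → P j ≢ P (suc j)
  segmentStart⇒boundary (e , _ , 1+j≤e , e≤N , same , maximal) flat =
    1+n≢n (sym (proj₁ (maximal j e 1≤j (n≤1+n j) ≤-refl e≤N same-from-j)))
    where
    to-start : ∀ x → j ≤ x → x ≤ e → P x ≡ P (suc j)
    to-start x j≤x x≤e with x ≤? j
    ... | yes x≤j = trans (cong P (≤-antisym x≤j j≤x)) flat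
    ... | no x≰j = same x (suc j) (≰⇒> x≰j) x≤e ≤-refl 1+j≤e
    same-from-j : SamePrefix s p Y j e
    same-from-j x y j≤x x≤e j≤y y≤e = trans (to-start x j≤x x≤e) (sym (to-start y j≤y y≤e))

  boundary⇒segmentStart : suc j ≤ N s → P j ≢ P (suc j) → IsSegmentStart s p Y (suc j)
  boundary⇒segmentStart 1+j≤N boundary
    with maximal-run (λ x → ≡-dec _≟S_ (P x) (P (suc j))) 1+j≤N refl
  ... | e , 1+j≤e , e≤N , run , stop = e , s≤s z≤n , 1+j≤e , e≤N , same , maximal
    where
    same : SamePrefix s p Y (suc j) e
    same x y 1+j≤x x≤e 1+j≤y y≤e = trans (run x 1+j≤x x≤e) (sym (run y 1+j≤y y≤e))
    maximal : ∀ b′ e′ → 1 ≤ b′ → b′ ≤ suc j → e ≤ e′ → e′ ≤ N s → SamePrefix s p Y b′ e′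
      → b′ ≡ suc j × e′ ≡ e
    maximal b′ e′ 1≤b′ b′≤1+j e≤e′ e′≤N same′ = b′≡1+j , e′≡e
      where
      1+j≤e′ = ≤-trans 1+j≤e e≤e′
      b′≡1+j : b′ ≡ suc j
      b′≡1+j with b′ ≤? j
      ... | yes b′≤j = ⊥-elim (boundary (same′ j (suc j) b′≤j (≤-trans (n≤1+n j) 1+j≤e′) b′≤1+j 1+j≤e′))
      ... | no b′≰j = ≤-antisym b′≤1+j (≰⇒> b′≰j)
      e′≡e : e′ ≡ e
      e′≡e with e′ ≤? e
      ... | yes e′≤e = ≤-antisym e′≤e e≤e′
      ... | no e′≰e = ⊥-elim (stop (<-≤-trans (≰⇒> e′≰e) e′≤N)
              (same′ (suc e) (suc j) (≤-trans b′≤1+j (m≤n⇒m≤1+n 1+j≤e)) (≰⇒> e′≰e) b′≤1+j 1+j≤e′))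

module _ {k m σ : ℕ} (s : Strings k m σ) where

  ExtLt⇒pre-≤L : ∀ p α β → ExtLt s α β → pre s p α ≤L pre s p β
  ExtLt⇒pre-≤L p _ _ α<β = LexLt⇒take-≤L α<β p

  Prec⇒pre-≤L : ∀ p α β → Prec s p α β → pre s p α ≤L pre s p β
  Prec⇒pre-≤L p _ _ (inj₁ α<β) = inj₁ α<β
  Prec⇒pre-≤L p _ _ (inj₂ (same , _)) = inj₂ same

  Prec-irrefl : ∀ p α → ¬ Prec s p α α
  Prec-irrefl p _ (inj₁ α<α) = LexLt-irrefl α<α
  Prec-irrefl p _ (inj₂ (_ , inj₁ l<l)) = <-irrefl refl l<l
  Prec-irrefl p _ (inj₂ (_ , inj₂ (_ , i<i))) = <-irrefl refl i<i

mainTheorem3 : {k m σ : ℕ} (s : Strings k m σ)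
    → (X : ℕ → Suffix k m) → IsSortedArray (ExtLt s) (N s) X
    → (Xp : ℕ → ℕ → Suffix k m) → ((p : ℕ) → IsSortedArray (Prec s p) (N s) (Xp p))
    → (i : ℕ) → 2 ≤ i → i ≤ N s
    → IsLargest (λ p → IsSegmentStart s (suc p) (Xp (suc p)) i × ¬ IsSegmentStart s p (Xp p) i) (LCP s X i)
mainTheorem3 {m = m} {σ} s X X-sorted Xp Xp-sorted (suc j@(suc _)) (s≤s (s≤s z≤n)) i≤N =
  IsLargest-cong
    (λ p (differ , agree) → differ⇒segmentStart (suc p) differ , λ start → segmentStart⇒differ p start agree)
    (λ p (start , ¬start) → segmentStart⇒differ (suc p) start ,
                             decidable-stable (≡-dec _≟S_ _ _) (¬start ∘ differ⇒segmentStart p))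
    (lcp-isLargest a≢b)
  where
  module K (q : ℕ) = KeyedArray (pre s q) (N s)
  a b : List (Sym m σ)
  a = ext s (X j)
  b = ext s (X (suc j))
  1≤j : 1 ≤ j
  1≤j = s≤s z≤n
  a≢b : a ≢ b
  a≢b a≡b = LexLt-irrefl (subst (λ u → LexLt u b) a≡b (proj₁ X-sorted j (suc j) 1≤j ≤-refl i≤N))
  X-keySorted : ∀ q → K.KeySorted q X
  X-keySorted q = K.sorted⇒keySorted q (ExtLt⇒pre-≤L s q) (λ _ → LexLt-irrefl) X-sorted
  Xp-keySorted : ∀ q → K.KeySorted q (Xp q)
  Xp-keySorted q = K.sorted⇒keySorted q (Prec⇒pre-≤L s q) (Prec-irrefl s q) (Xp-sorted q)
  segmentStart⇒differ : ∀ q → IsSegmentStart s q (Xp q) (suc j) → take q a ≢ take q b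
  segmentStart⇒differ q =
    K.boundary-transfer q (X-keySorted q) (Xp-keySorted q) 1≤j i≤N ∘ segmentStart⇒boundary s q (Xp q) 1≤j
  differ⇒segmentStart : ∀ q → take q a ≢ take q b → IsSegmentStart s q (Xp q) (suc j)
  differ⇒segmentStart q =
    boundary⇒segmentStart s q (Xp q) 1≤j i≤N ∘ K.boundary-transfer q (Xp-keySorted q) (X-keySorted q) 1≤j i≤N
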